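{- Let $s$ be a positive integer. For every integer $k\ge 1$, $$\sum_{n=k}^\infty\left\{ {n \atop k} \right\}_s\frac{x^n}{n!}=\sum_{j=1}^k\frac{e^{j^s x}}{\prod_{i=0,\, i\ne j}^k(j^s-i^s)}+\frac{(-1)^k}{(k!)^s}.$$
   Context: For a positive integer $s$, the Stirling numbers of the second kind with level $s$, $\left\{ {n \atop k} \right\}_s$ ($n,k\ge 0$), are defined by the recurrence $\left\{ {n \atop k} \right\}_s=\left\{ {n-1 \atop k-1} \right\}_s+k^s\left\{ {n-1 \atop k} \right\}_s$ with $\left\{ {0 \atop 0} \right\}_s=1$ and $\left\{ {n \atop 0} \right\}_s=\left\{ {0 \atop n} \right\}_s=0$ for $n\ge 1$. The identity is an identity of power series in $x$. -}

module Defs where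

open import Data.Nat as ℕ using (ℕ; zero; suc; _≤?_; _≡ᵇ_)
open import Data.Nat using (_!)
open import Data.Integer as ℤ using (ℤ; +_; -[1+_])
open import Data.Rational using (ℚ; _/_; 0ℚ; _+_; _*_)
open import Data.Bool using (if_then_else_)
open import Relation.Nullary using (yes; no)

S : ℕ → ℕ → ℕ → ℕ
S s zero    zero    = 1
S s zero    (suc k) = 0
S s (suc n) zero    = 0
S s (suc n) (suc k) = S s n k ℕ.+ (suc k ℕ.^ s) ℕ.* S s n (suc k)

ℤ→ℚ : ℤ → ℚ
ℤ→ℚ z = z / 1

ℕ→ℚ : ℕ → ℚ
ℕ→ℚ n = + n / 1

-- reciprocal 1/z of an integer z (only used at nonzero z; 1/0 := 0)
inv : ℤ → ℚ
inv (+ zero)   = 0ℚ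
inv (+ suc n)  = + 1 / suc n
inv -[1+ n ]   = -[1+ 0 ] / suc n

sumBelow : ℕ → (ℕ → ℚ) → ℚ
sumBelow zero    f = 0ℚ
sumBelow (suc m) f = sumBelow m f + f m

prodBelowℤ : ℕ → (ℕ → ℤ) → ℤ
prodBelowℤ zero    f = + 1
prodBelowℤ (suc m) f = prodBelowℤ m f ℤ.* f m

-- Formal power series in x over ℚ, represented by their coefficient
-- sequences: F n = coefficient of x^n.

FPS : Set
FPS = ℕ → ℚ

_⊕_ : FPS → FPS → FPS
(F ⊕ G) n = F n + G n

_⊙_ : ℚ → FPS → FPS
(c ⊙ F) n = c * F n

const : ℚ → FPS
const c zero    = c
const c (suc n) = 0ℚ

ΣFPS : ℕ → (ℕ → FPS) → FPS
ΣFPS zero    F = const 0ℚ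
ΣFPS (suc k) F = ΣFPS k F ⊕ F (suc k)

expS : ℤ → FPS
expS a n = ℤ→ℚ (a ℤ.^ n) * inv (+ (n !))

lhsSeries : ℕ → ℕ → FPS
lhsSeries s k n with k ≤? n
... | yes _ = ℕ→ℚ (S s n k) * inv (+ (n !))
... | no  _ = 0ℚ

denom : ℕ → ℕ → ℕ → ℤ
denom s k j = prodBelowℤ (suc k)
  (λ i → if i ≡ᵇ j then + 1 else (+ (j ℕ.^ s) ℤ.- + (i ℕ.^ s)))

rhsSeries : ℕ → ℕ → FPS
rhsSeries s k =
  ΣFPS k (λ j → inv (denom s k j) ⊙ expS (+ (j ℕ.^ s)))
  ⊕ const (ℤ→ℚ (-[1+ 0 ] ℤ.^ k) * inv (+ ((k !) ℕ.^ s)))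

-- For distinct nodes a₀, …, a_k the divided difference of x ↦ xⁿ,
--   D_k(n) = Σ_{j ≤ k} a_jⁿ / Π_{i ≤ k, i ≠ j} (a_j − a_i),
-- satisfies D_{k+1}(n+1) = D_k(n) + a_{k+1} D_{k+1}(n) (write a_j = (a_j − a_{k+1}) + a_{k+1}
-- in each summand) and D_k(0) = [k = 0]. At the nodes a_i = iˢ this is the Stirling
-- recurrence, so D_k(n) = {n atop k}_s. The coefficient of xⁿ/n! on the right-hand side is
-- D_k(n) minus its j = 0 summand; that summand vanishes for n ≥ 1, and for n = 0 it is
-- 1/Π_{i=1}^{k}(−iˢ) = (−1)ᵏ/(k!)ˢ, which the constant term exactly compensates.
module Submission where

open import Defs
open import Data.Nat using (ℕ; _≤_)
open import Relation.Binary.PropositionalEquality using (_≡_)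

open import Data.Bool using (false; if_then_else_)
open import Data.Empty using (⊥-elim)
open import Data.Maybe.Base using (nothing)
open import Data.Nat as ℕ using (zero; suc; _<_; _≡ᵇ_; _≤?_; _!; s≤s)
import Data.Nat.Properties as ℕ
open import Data.Nat.Coprimality using (1-coprimeTo)
import Data.Nat.Coprimality as Coprime
import Data.Nat.Tactic.RingSolver as ℕ-Solver
open import Data.Integer as ℤ using (ℤ; +_; -[1+_])
import Data.Integer.Properties as ℤ
import Data.Integer.Tactic.RingSolver as ℤ-Solver
open import Data.Rational using (ℚ; mkℚ; _+_; _*_; -_; 0ℚ; 1ℚ)
import Data.Rational.Properties as ℚ
open import Data.Sum using (inj₁; inj₂)
open import Function using (_∘_)
open import Function.Definitions using (Injective)
open import Level using (0ℓ)
open import Relation.Binary using (tri<; tri≈; tri>)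
open import Relation.Binary.PropositionalEquality
  using (refl; sym; trans; cong; cong₂; _≢_; module ≡-Reasoning)
open import Relation.Nullary using (yes; no)
open import Algebra.Properties.Group ℚ.+-0-group using (∙-cancelˡ; ∙-cancelʳ)
open import Algebra.Bundles using (CommutativeMonoid)
open import Algebra.Properties.CommutativeSemigroup
  (CommutativeMonoid.commutativeSemigroup ℚ.*-1-commutativeMonoid)
  using ()
  renaming (interchange to *-interchange; x∙yz≈y∙xz to *-x∙yz≈y∙xz)
open import Tactic.RingSolver using (solve-∀)
open import Tactic.RingSolver.Core.AlmostCommutativeRing
  using (AlmostCommutativeRing; fromCommutativeRing)

open ≡-Reasoning

ℚ-ring : AlmostCommutativeRing 0ℓ 0ℓ
ℚ-ring = fromCommutativeRing ℚ.+-*-commutativeRing (λ _ → nothing)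

ℤ→ℚ≡mkℚ : ∀ z → ℤ→ℚ z ≡ mkℚ z 0 (Coprime.sym (1-coprimeTo ℤ.∣ z ∣))
ℤ→ℚ≡mkℚ (+ n)    = ℚ.normalize-coprime (Coprime.sym (1-coprimeTo n))
ℤ→ℚ≡mkℚ -[1+ n ] = cong -_ (ℚ.normalize-coprime (Coprime.sym (1-coprimeTo (suc n))))

ℤ→ℚ-* : ∀ x y → ℤ→ℚ (x ℤ.* y) ≡ ℤ→ℚ x * ℤ→ℚ y
ℤ→ℚ-* x y = sym (cong₂ _*_ (ℤ→ℚ≡mkℚ x) (ℤ→ℚ≡mkℚ y))

-- On integers, ℚ's _+_ computes x / 1 + y / 1 as (x * 1 + y * 1) / 1.
ℤ→ℚ-+ : ∀ x y → ℤ→ℚ (x ℤ.+ y) ≡ ℤ→ℚ x + ℤ→ℚ y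
ℤ→ℚ-+ x y = begin
  ℤ→ℚ (x ℤ.+ y)                          ≡⟨ cong ℤ→ℚ (sym (cong₂ ℤ._+_ (ℤ.*-identityʳ x) (ℤ.*-identityʳ y))) ⟩
  ℤ→ℚ (x ℤ.* + 1 ℤ.+ y ℤ.* + 1)          ≡⟨ sym (cong₂ _+_ (ℤ→ℚ≡mkℚ x) (ℤ→ℚ≡mkℚ y)) ⟩
  ℤ→ℚ x + ℤ→ℚ y                          ∎

ℕ→ℚ-+ : ∀ m n → ℕ→ℚ (m ℕ.+ n) ≡ ℕ→ℚ m + ℕ→ℚ n
ℕ→ℚ-+ m n = trans (cong ℤ→ℚ (ℤ.pos-+ m n)) (ℤ→ℚ-+ (+ m) (+ n))

ℕ→ℚ-* : ∀ m n → ℕ→ℚ (m ℕ.* n) ≡ ℕ→ℚ m * ℕ→ℚ n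
ℕ→ℚ-* m n = trans (cong ℤ→ℚ (ℤ.pos-* m n)) (ℤ→ℚ-* (+ m) (+ n))

inv-inverseˡ : ∀ {z} → z ≢ + 0 → inv z * ℤ→ℚ z ≡ 1ℚ
inv-inverseˡ {+ zero}   z≢0 = ⊥-elim (z≢0 refl)
inv-inverseˡ {+ suc n}  _   =
  trans (cong₂ _*_ (ℚ.normalize-coprime (1-coprimeTo (suc n))) (ℤ→ℚ≡mkℚ (+ suc n)))
        (ℚ.*-inverseˡ (mkℚ (+ suc n) 0 (Coprime.sym (1-coprimeTo (suc n)))))
inv-inverseˡ { -[1+ n ]} _  =
  trans (cong₂ _*_ (cong -_ (ℚ.normalize-coprime (1-coprimeTo (suc n)))) (ℤ→ℚ≡mkℚ -[1+ n ]))
        (ℚ.*-inverseˡ (mkℚ -[1+ n ] 0 (Coprime.sym (1-coprimeTo (suc n)))))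

inv-unique : ∀ r {z} → z ≢ + 0 → r * ℤ→ℚ z ≡ 1ℚ → r ≡ inv z
inv-unique r {z} z≢0 rz≡1 = begin
  r                       ≡⟨ sym (ℚ.*-identityʳ r) ⟩
  r * 1ℚ                  ≡⟨ cong (r *_) (sym (inv-inverseˡ z≢0)) ⟩
  r * (inv z * ℤ→ℚ z)     ≡⟨ cong (r *_) (ℚ.*-comm (inv z) (ℤ→ℚ z)) ⟩
  r * (ℤ→ℚ z * inv z)     ≡⟨ sym (ℚ.*-assoc r (ℤ→ℚ z) (inv z)) ⟩
  r * ℤ→ℚ z * inv z       ≡⟨ cong (_* inv z) rz≡1 ⟩
  1ℚ * inv z              ≡⟨ ℚ.*-identityˡ (inv z) ⟩
  inv z                   ∎

-- inv 0 = 0 makes inv multiplicative without side conditions.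
inv-* : ∀ x y → inv (x ℤ.* y) ≡ inv x * inv y
inv-* x y with x ℤ.≟ + 0 | y ℤ.≟ + 0
... | yes refl | _        = sym (ℚ.*-zeroˡ (inv y))
... | no _     | yes refl = trans (cong inv (ℤ.*-zeroʳ x)) (sym (ℚ.*-zeroʳ (inv x)))
... | no x≢0   | no y≢0   = sym (inv-unique (inv x * inv y) xy≢0 (begin
  inv x * inv y * ℤ→ℚ (x ℤ.* y)              ≡⟨ cong (inv x * inv y *_) (ℤ→ℚ-* x y) ⟩
  inv x * inv y * (ℤ→ℚ x * ℤ→ℚ y)            ≡⟨ *-interchange (inv x) (inv y) (ℤ→ℚ x) (ℤ→ℚ y) ⟩
  (inv x * ℤ→ℚ x) * (inv y * ℤ→ℚ y)          ≡⟨ cong₂ _*_ (inv-inverseˡ x≢0) (inv-inverseˡ y≢0) ⟩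
  1ℚ                                          ∎))
  where
  xy≢0 : x ℤ.* y ≢ + 0
  xy≢0 xy≡0 with ℤ.i*j≡0⇒i≡0∨j≡0 x xy≡0
  ... | inj₁ x≡0 = x≢0 x≡0
  ... | inj₂ y≡0 = y≢0 y≡0

inv-sign : ∀ k → inv (-[1+ 0 ] ℤ.^ k) ≡ ℤ→ℚ (-[1+ 0 ] ℤ.^ k)
inv-sign zero    = refl
inv-sign (suc k) = begin
  inv (-[1+ 0 ] ℤ.* -[1+ 0 ] ℤ.^ k)        ≡⟨ inv-* -[1+ 0 ] (-[1+ 0 ] ℤ.^ k) ⟩
  inv -[1+ 0 ] * inv (-[1+ 0 ] ℤ.^ k)      ≡⟨ cong (inv -[1+ 0 ] *_) (inv-sign k) ⟩
  ℤ→ℚ -[1+ 0 ] * ℤ→ℚ (-[1+ 0 ] ℤ.^ k)      ≡⟨ sym (ℤ→ℚ-* -[1+ 0 ] (-[1+ 0 ] ℤ.^ k)) ⟩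
  ℤ→ℚ (-[1+ 0 ] ℤ.* -[1+ 0 ] ℤ.^ k)        ∎

ℤ→ℚ-split : ∀ u c → ℤ→ℚ u ≡ ℤ→ℚ (u ℤ.- c) + ℤ→ℚ c
ℤ→ℚ-split u c = trans (cong ℤ→ℚ (u≡u-c+c u c)) (ℤ→ℚ-+ (u ℤ.- c) c)
  where
  u≡u-c+c : ∀ u c → u ≡ (u ℤ.- c) ℤ.+ c
  u≡u-c+c = ℤ-Solver.solve-∀

ℤ→ℚ-*-cancelʳ : ∀ {u c} t → u ≢ c → ℤ→ℚ u * t ≡ ℤ→ℚ c * t → t ≡ 0ℚ
ℤ→ℚ-*-cancelʳ {u} {c} t u≢c ut≡ct = begin
  t                                ≡⟨ sym (ℚ.*-identityˡ t) ⟩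
  1ℚ * t                           ≡⟨ cong (_* t) (sym (inv-inverseˡ d≢0)) ⟩
  inv d * ℤ→ℚ d * t                ≡⟨ ℚ.*-assoc (inv d) (ℤ→ℚ d) t ⟩
  inv d * (ℤ→ℚ d * t)              ≡⟨ cong (inv d *_) dt≡0 ⟩
  inv d * 0ℚ                       ≡⟨ ℚ.*-zeroʳ (inv d) ⟩
  0ℚ                               ∎
  where
  d = u ℤ.- c
  d≢0 : d ≢ + 0
  d≢0 = u≢c ∘ ℤ.i-j≡0⇒i≡j u c
  dt≡0 : ℤ→ℚ d * t ≡ 0ℚ
  dt≡0 = ∙-cancelʳ (ℤ→ℚ c * t) (ℤ→ℚ d * t) 0ℚ (begin
    ℤ→ℚ d * t + ℤ→ℚ c * t          ≡⟨ sym (ℚ.*-distribʳ-+ t (ℤ→ℚ d) (ℤ→ℚ c)) ⟩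
    (ℤ→ℚ d + ℤ→ℚ c) * t            ≡⟨ cong (_* t) (sym (ℤ→ℚ-split u c)) ⟩
    ℤ→ℚ u * t                      ≡⟨ ut≡ct ⟩
    ℤ→ℚ c * t                      ≡⟨ sym (ℚ.+-identityˡ (ℤ→ℚ c * t)) ⟩
    0ℚ + ℤ→ℚ c * t                 ∎)

sumBelow-cong : ∀ m {f g : ℕ → ℚ} → (∀ j → j < m → f j ≡ g j) → sumBelow m f ≡ sumBelow m g
sumBelow-cong zero    f≗g = refl
sumBelow-cong (suc m) f≗g =
  cong₂ _+_ (sumBelow-cong m (λ j j<m → f≗g j (ℕ.m<n⇒m<1+n j<m))) (f≗g m ℕ.≤-refl)

sumBelow-+-* : ∀ m (f g : ℕ → ℚ) c →
  sumBelow m (λ j → f j + c * g j) ≡ sumBelow m f + c * sumBelow m g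
sumBelow-+-* zero    f g c = sym (trans (ℚ.+-identityˡ (c * 0ℚ)) (ℚ.*-zeroʳ c))
sumBelow-+-* (suc m) f g c = begin
  sumBelow m (λ j → f j + c * g j) + (f m + c * g m)     ≡⟨ cong (_+ (f m + c * g m)) (sumBelow-+-* m f g c) ⟩
  (sumBelow m f + c * sumBelow m g) + (f m + c * g m)    ≡⟨ regroup (sumBelow m f) (sumBelow m g) (f m) (g m) c ⟩
  (sumBelow m f + f m) + c * (sumBelow m g + g m)        ∎
  where
  regroup : ∀ A B x y c → (A + c * B) + (x + c * y) ≡ (A + x) + c * (B + y)
  regroup = solve-∀ ℚ-ring

sumBelow-*ʳ : ∀ m (f : ℕ → ℚ) c → sumBelow m (λ j → f j * c) ≡ sumBelow m f * c
sumBelow-*ʳ zero    f c = sym (ℚ.*-zeroˡ c)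
sumBelow-*ʳ (suc m) f c =
  trans (cong (_+ f m * c) (sumBelow-*ʳ m f c)) (sym (ℚ.*-distribʳ-+ c (sumBelow m f) (f m)))

sumBelow-shift : ∀ m (f : ℕ → ℚ) → sumBelow (suc m) f ≡ f 0 + sumBelow m (f ∘ suc)
sumBelow-shift zero    f = trans (ℚ.+-identityˡ (f 0)) (sym (ℚ.+-identityʳ (f 0)))
sumBelow-shift (suc m) f = trans (cong (_+ f (suc m)) (sumBelow-shift m f)) (ℚ.+-assoc (f 0) _ _)

prodBelowℤ-shift : ∀ m (f : ℕ → ℤ) → prodBelowℤ (suc m) f ≡ f 0 ℤ.* prodBelowℤ m (f ∘ suc)
prodBelowℤ-shift zero    f = trans (ℤ.*-identityˡ (f 0)) (sym (ℤ.*-identityʳ (f 0)))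
prodBelowℤ-shift (suc m) f = trans (cong (ℤ._* f (suc m)) (prodBelowℤ-shift m f)) (ℤ.*-assoc (f 0) _ _)

ΣFPS-sumBelow : ∀ k (F : ℕ → FPS) n → ΣFPS k F n ≡ sumBelow k (λ j → F (suc j) n)
ΣFPS-sumBelow zero    F zero    = refl
ΣFPS-sumBelow zero    F (suc n) = refl
ΣFPS-sumBelow (suc k) F n       = cong (_+ F (suc k) n) (ΣFPS-sumBelow k F n)

-- Divided differences of x ↦ xⁿ at integer nodes a₀, a₁, …

≢⇒≡ᵇ≡false : ∀ {m n} → m ≢ n → (m ≡ᵇ n) ≡ false
≢⇒≡ᵇ≡false {zero}  {zero}  m≢n = ⊥-elim (m≢n refl)
≢⇒≡ᵇ≡false {zero}  {suc n} _   = refl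
≢⇒≡ᵇ≡false {suc m} {zero}  _   = refl
≢⇒≡ᵇ≡false {suc m} {suc n} m≢n = ≢⇒≡ᵇ≡false (m≢n ∘ cong suc)

-- Defs.denom s k is lagrangeDenom (λ i → + (i ^ s)) k, definitionally.
lagrangeDenom : (ℕ → ℤ) → ℕ → ℕ → ℤ
lagrangeDenom a k j = prodBelowℤ (suc k) (λ i → if i ≡ᵇ j then + 1 else (a j ℤ.- a i))

lagrangeTerm : (ℕ → ℤ) → ℕ → ℕ → ℕ → ℚ
lagrangeTerm a k n j = inv (lagrangeDenom a k j) * ℤ→ℚ (a j ℤ.^ n)

dividedPower : (ℕ → ℤ) → ℕ → ℕ → ℚ
dividedPower a k n = sumBelow (suc k) (lagrangeTerm a k n)

lagrangeDenom-sucʳ : ∀ a k {j} → j ≢ suc k →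
  lagrangeDenom a (suc k) j ≡ lagrangeDenom a k j ℤ.* (a j ℤ.- a (suc k))
lagrangeDenom-sucʳ a k {j} j≢1+k =
  cong (λ b → lagrangeDenom a k j ℤ.* (if b then + 1 else (a j ℤ.- a (suc k))))
       (≢⇒≡ᵇ≡false (j≢1+k ∘ sym))

lagrangeDenom-sucˡ : ∀ a k j →
  lagrangeDenom a (suc k) (suc j) ≡ lagrangeDenom (a ∘ suc) k j ℤ.* (a (suc j) ℤ.- a 0)
lagrangeDenom-sucˡ a k j = trans
  (prodBelowℤ-shift (suc k) (λ i → if i ≡ᵇ suc j then + 1 else (a (suc j) ℤ.- a i)))
  (ℤ.*-comm (a (suc j) ℤ.- a 0) (lagrangeDenom (a ∘ suc) k j))

lagrangeTerm-suc : ∀ a k n j → lagrangeTerm a k (suc n) j ≡ ℤ→ℚ (a j) * lagrangeTerm a k n j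
lagrangeTerm-suc a k n j =
  trans (cong (inv (lagrangeDenom a k j) *_) (ℤ→ℚ-* (a j) (a j ℤ.^ n)))
        (*-x∙yz≈y∙xz (inv (lagrangeDenom a k j)) (ℤ→ℚ (a j)) (ℤ→ℚ (a j ℤ.^ n)))

-- Writing u = (u − c) + c, the factor u − c cancels against the denominator.
inv-pow-split : ∀ {D′} D {u c} n → D′ ≡ D ℤ.* (u ℤ.- c) → u ≢ c →
  inv D′ * ℤ→ℚ (u ℤ.^ suc n) ≡ inv D * ℤ→ℚ (u ℤ.^ n) + ℤ→ℚ c * (inv D′ * ℤ→ℚ (u ℤ.^ n))
inv-pow-split D {u} {c} n refl u≢c = begin
  inv (D ℤ.* d) * ℤ→ℚ (u ℤ.* u ℤ.^ n)                ≡⟨ cong₂ _*_ (inv-* D d) (ℤ→ℚ-* u (u ℤ.^ n)) ⟩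
  inv D * inv d * (ℤ→ℚ u * P)                        ≡⟨ cong (λ x → inv D * inv d * (x * P)) (ℤ→ℚ-split u c) ⟩
  inv D * inv d * ((ℤ→ℚ d + ℤ→ℚ c) * P)              ≡⟨ expand (inv D) (inv d) (ℤ→ℚ d) (ℤ→ℚ c) P ⟩
  inv D * (inv d * ℤ→ℚ d) * P + ℤ→ℚ c * (inv D * inv d * P)
      ≡⟨ cong₂ (λ x y → inv D * x * P + ℤ→ℚ c * (y * P)) (inv-inverseˡ d≢0) (sym (inv-* D d)) ⟩
  inv D * 1ℚ * P + ℤ→ℚ c * (inv (D ℤ.* d) * P)       ≡⟨ cong (λ x → x * P + ℤ→ℚ c * (inv (D ℤ.* d) * P)) (ℚ.*-identityʳ (inv D)) ⟩
  inv D * P + ℤ→ℚ c * (inv (D ℤ.* d) * P)            ∎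
  where
  d = u ℤ.- c
  P = ℤ→ℚ (u ℤ.^ n)
  d≢0 : d ≢ + 0
  d≢0 = u≢c ∘ ℤ.i-j≡0⇒i≡j u c
  expand : ∀ A B X C P → A * B * ((X + C) * P) ≡ A * (B * X) * P + C * (A * B * P)
  expand = solve-∀ ℚ-ring

module _ {a : ℕ → ℤ} (a-inj : Injective _≡_ _≡_ a) where

  dividedPower-sucʳ : ∀ k n →
    dividedPower a (suc k) (suc n) ≡ dividedPower a k n + ℤ→ℚ (a (suc k)) * dividedPower a (suc k) n
  dividedPower-sucʳ k n = begin
    sumBelow (suc k) F + F (suc k)
      ≡⟨ cong₂ _+_ (sumBelow-cong (suc k) split) (lagrangeTerm-suc a (suc k) n (suc k)) ⟩
    sumBelow (suc k) (λ j → G j + c * H j) + c * H (suc k)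
      ≡⟨ cong (_+ c * H (suc k)) (sumBelow-+-* (suc k) G H c) ⟩
    sumBelow (suc k) G + c * sumBelow (suc k) H + c * H (suc k)
      ≡⟨ regroup (sumBelow (suc k) G) (sumBelow (suc k) H) (H (suc k)) c ⟩
    sumBelow (suc k) G + c * (sumBelow (suc k) H + H (suc k))
      ∎
    where
    c = ℤ→ℚ (a (suc k))
    F = lagrangeTerm a (suc k) (suc n)
    G = lagrangeTerm a k n
    H = lagrangeTerm a (suc k) n
    split : ∀ j → j < suc k → F j ≡ G j + c * H j
    split j j<1+k = inv-pow-split (lagrangeDenom a k j) n
      (lagrangeDenom-sucʳ a k j≢1+k) (j≢1+k ∘ a-inj)
      where j≢1+k = ℕ.<⇒≢ j<1+k
    regroup : ∀ A B C c → A + c * B + c * C ≡ A + c * (B + C)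
    regroup = solve-∀ ℚ-ring

  dividedPower-sucˡ : ∀ k n →
    dividedPower a (suc k) (suc n) ≡ dividedPower (a ∘ suc) k n + ℤ→ℚ (a 0) * dividedPower a (suc k) n
  dividedPower-sucˡ k n = begin
    dividedPower a (suc k) (suc n)
      ≡⟨ sumBelow-shift (suc k) F ⟩
    F 0 + sumBelow (suc k) (F ∘ suc)
      ≡⟨ cong₂ _+_ (lagrangeTerm-suc a (suc k) n 0)
                   (trans (sumBelow-cong (suc k) split) (sumBelow-+-* (suc k) G (H ∘ suc) c)) ⟩
    c * H 0 + (sumBelow (suc k) G + c * sumBelow (suc k) (H ∘ suc))
      ≡⟨ regroup (H 0) (sumBelow (suc k) G) (sumBelow (suc k) (H ∘ suc)) c ⟩
    sumBelow (suc k) G + c * (H 0 + sumBelow (suc k) (H ∘ suc))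
      ≡⟨ cong (λ x → sumBelow (suc k) G + c * x) (sym (sumBelow-shift (suc k) H)) ⟩
    dividedPower (a ∘ suc) k n + c * dividedPower a (suc k) n
      ∎
    where
    c = ℤ→ℚ (a 0)
    F = lagrangeTerm a (suc k) (suc n)
    G = lagrangeTerm (a ∘ suc) k n
    H = lagrangeTerm a (suc k) n
    split : ∀ j → j < suc k → F (suc j) ≡ G j + c * H (suc j)
    split j _ = inv-pow-split (lagrangeDenom (a ∘ suc) k j) n
      (lagrangeDenom-sucˡ a k j) (λ a₁₊ⱼ≡a₀ → ℕ.1+n≢0 (a-inj a₁₊ⱼ≡a₀))
    regroup : ∀ h A B c → c * h + (A + c * B) ≡ A + c * (h + B)
    regroup = solve-∀ ℚ-ring

δ : ℕ → ℚ
δ zero    = 1ℚ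
δ (suc _) = 0ℚ

-- Splitting off a_{k+1} or a₀ gives D_{k+1}(1) = δ k + a_{k+1} D_{k+1}(0) = δ k + a₀ D_{k+1}(0),
-- and a_{k+1} ≠ a₀.
dividedPower-zero : ∀ {a} → Injective _≡_ _≡_ a → ∀ k → dividedPower a k 0 ≡ δ k
dividedPower-zero a-inj zero = refl
dividedPower-zero {a} a-inj (suc k) =
  ℤ→ℚ-*-cancelʳ t (λ a₁₊ₖ≡a₀ → ℕ.1+n≢0 (a-inj a₁₊ₖ≡a₀)) (∙-cancelˡ (δ k) _ _ (begin
    δ k + ℤ→ℚ (a (suc k)) * t
      ≡⟨ cong (_+ ℤ→ℚ (a (suc k)) * t) (sym (dividedPower-zero a-inj k)) ⟩
    dividedPower a k 0 + ℤ→ℚ (a (suc k)) * t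
      ≡⟨ sym (dividedPower-sucʳ a-inj k 0) ⟩
    dividedPower a (suc k) 1
      ≡⟨ dividedPower-sucˡ a-inj k 0 ⟩
    dividedPower (a ∘ suc) k 0 + ℤ→ℚ (a 0) * t
      ≡⟨ cong (_+ ℤ→ℚ (a 0) * t) (dividedPower-zero (ℕ.suc-injective ∘ a-inj) k) ⟩
    δ k + ℤ→ℚ (a 0) * t
      ∎))
  where t = dividedPower a (suc k) 0

-- Stirling numbers as divided differences at the nodes iˢ

levelPowers : ℕ → ℕ → ℤ
levelPowers s i = + (i ℕ.^ s)

levelPowers-injective : ∀ s .{{_ : ℕ.NonZero s}} → Injective _≡_ _≡_ (levelPowers s)
levelPowers-injective s {i} {j} iˢ≡jˢ with ℕ.<-cmp i j
... | tri< i<j _ _ = ⊥-elim (ℕ.<⇒≢ (ℕ.^-monoˡ-< s i<j) (cong ℤ.∣_∣ iˢ≡jˢ))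
... | tri≈ _ i≡j _ = i≡j
... | tri> _ _ j<i = ⊥-elim (ℕ.<⇒≢ (ℕ.^-monoˡ-< s j<i) (cong ℤ.∣_∣ (sym iˢ≡jˢ)))

dividedPower-levelPowers : ∀ s n k → dividedPower (levelPowers (suc s)) k n ≡ ℕ→ℚ (S (suc s) n k)
dividedPower-levelPowers s zero    zero    = dividedPower-zero (levelPowers-injective (suc s)) 0
dividedPower-levelPowers s zero    (suc k) = dividedPower-zero (levelPowers-injective (suc s)) (suc k)
dividedPower-levelPowers s (suc n) zero    = refl
dividedPower-levelPowers s (suc n) (suc k) = begin
  dividedPower a (suc k) (suc n)
    ≡⟨ dividedPower-sucʳ (levelPowers-injective (suc s)) k n ⟩
  dividedPower a k n + ℕ→ℚ (suc k ℕ.^ suc s) * dividedPower a (suc k) n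
    ≡⟨ cong₂ (λ x y → x + ℕ→ℚ (suc k ℕ.^ suc s) * y)
             (dividedPower-levelPowers s n k) (dividedPower-levelPowers s n (suc k)) ⟩
  ℕ→ℚ (S (suc s) n k) + ℕ→ℚ (suc k ℕ.^ suc s) * ℕ→ℚ (S (suc s) n (suc k))
    ≡⟨ cong (λ x → ℕ→ℚ (S (suc s) n k) + x) (sym (ℕ→ℚ-* (suc k ℕ.^ suc s) (S (suc s) n (suc k)))) ⟩
  ℕ→ℚ (S (suc s) n k) + ℕ→ℚ (suc k ℕ.^ suc s ℕ.* S (suc s) n (suc k))
    ≡⟨ sym (ℕ→ℚ-+ (S (suc s) n k) _) ⟩
  ℕ→ℚ (S (suc s) (suc n) (suc k))
    ∎
  where a = levelPowers (suc s)

n<k⇒S≡0 : ∀ s {n k} → n < k → S s n k ≡ 0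
n<k⇒S≡0 s {zero}  {suc k} _         = refl
n<k⇒S≡0 s {suc n} {suc k} (s≤s n<k)
  rewrite n<k⇒S≡0 s n<k | n<k⇒S≡0 s (ℕ.m<n⇒m<1+n n<k) = ℕ.*-zeroʳ (suc k ℕ.^ s)

*-^-distrib : ∀ m n o → (m ℕ.* n) ℕ.^ o ≡ m ℕ.^ o ℕ.* n ℕ.^ o
*-^-distrib m n zero    = refl
*-^-distrib m n (suc o) = trans (cong (m ℕ.* n ℕ.*_) (*-^-distrib m n o))
                               (rearrange m n (m ℕ.^ o) (n ℕ.^ o))
  where
  rearrange : ∀ m n p q → m ℕ.* n ℕ.* (p ℕ.* q) ≡ m ℕ.* p ℕ.* (n ℕ.* q)
  rearrange = ℕ-Solver.solve-∀

lagrangeDenom-levelPowers-zero : ∀ s k →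
  lagrangeDenom (levelPowers (suc s)) k 0 ≡ -[1+ 0 ] ℤ.^ k ℤ.* + ((k !) ℕ.^ suc s)
lagrangeDenom-levelPowers-zero s zero =
  sym (trans (ℤ.*-identityˡ _) (cong +_ (ℕ.^-zeroˡ (suc s))))
lagrangeDenom-levelPowers-zero s (suc k) = begin
  lagrangeDenom a (suc k) 0
    ≡⟨ lagrangeDenom-sucʳ a k (λ ()) ⟩
  lagrangeDenom a k 0 ℤ.* (+ 0 ℤ.- + m)
    ≡⟨ cong (ℤ._* (+ 0 ℤ.- + m)) (lagrangeDenom-levelPowers-zero s k) ⟩
  ε ℤ.* + f ℤ.* (+ 0 ℤ.- + m)
    ≡⟨ rearrange ε (+ f) (+ m) ⟩
  -[1+ 0 ] ℤ.* ε ℤ.* (+ m ℤ.* + f)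
    ≡⟨ cong (-[1+ 0 ] ℤ.* ε ℤ.*_) (sym (ℤ.pos-* m f)) ⟩
  -[1+ 0 ] ℤ.* ε ℤ.* + (m ℕ.* f)
    ≡⟨ cong (λ x → -[1+ 0 ] ℤ.* ε ℤ.* + x) (sym (*-^-distrib (suc k) (k !) (suc s))) ⟩
  -[1+ 0 ] ℤ.^ suc k ℤ.* + ((suc k !) ℕ.^ suc s)
    ∎
  where
  a = levelPowers (suc s)
  m = suc k ℕ.^ suc s
  f = (k !) ℕ.^ suc s
  ε = -[1+ 0 ] ℤ.^ k
  rearrange : ∀ ε f m → ε ℤ.* f ℤ.* (+ 0 ℤ.- m) ≡ -[1+ 0 ] ℤ.* ε ℤ.* (m ℤ.* f)
  rearrange = ℤ-Solver.solve-∀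

ΣFPS-lagrange : ∀ a k n →
  ΣFPS k (λ j → inv (lagrangeDenom a k j) ⊙ expS (a j)) n + lagrangeTerm a k n 0 * inv (+ (n !))
    ≡ dividedPower a k n * inv (+ (n !))
ΣFPS-lagrange a k n = begin
  ΣFPS k (λ j → inv (lagrangeDenom a k j) ⊙ expS (a j)) n + T 0 * N
    ≡⟨ cong (_+ T 0 * N) (ΣFPS-sumBelow k _ n) ⟩
  sumBelow k (λ j → inv (lagrangeDenom a k (suc j)) * (ℤ→ℚ (a (suc j) ℤ.^ n) * N)) + T 0 * N
    ≡⟨ cong (_+ T 0 * N) (sumBelow-cong k (λ j _ →
         sym (ℚ.*-assoc (inv (lagrangeDenom a k (suc j))) (ℤ→ℚ (a (suc j) ℤ.^ n)) N))) ⟩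
  sumBelow k (λ j → T (suc j) * N) + T 0 * N
    ≡⟨ cong (_+ T 0 * N) (sumBelow-*ʳ k (T ∘ suc) N) ⟩
  sumBelow k (T ∘ suc) * N + T 0 * N
    ≡⟨ ℚ.+-comm _ (T 0 * N) ⟩
  T 0 * N + sumBelow k (T ∘ suc) * N
    ≡⟨ sym (ℚ.*-distribʳ-+ N (T 0) _) ⟩
  (T 0 + sumBelow k (T ∘ suc)) * N
    ≡⟨ cong (_* N) (sym (sumBelow-shift k T)) ⟩
  dividedPower a k n * N
    ∎
  where
  T = lagrangeTerm a k n
  N = inv (+ (n !))

lhsSeries-coeff : ∀ s k n → lhsSeries s k n ≡ ℕ→ℚ (S s n k) * inv (+ (n !))
lhsSeries-coeff s k n with k ≤? n
... | yes _  = refl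
... | no k≰n = sym (begin
  ℕ→ℚ (S s n k) * inv (+ (n !))    ≡⟨ cong (λ x → ℕ→ℚ x * inv (+ (n !))) (n<k⇒S≡0 s (ℕ.≰⇒> k≰n)) ⟩
  0ℚ * inv (+ (n !))               ≡⟨ ℚ.*-zeroˡ (inv (+ (n !))) ⟩
  0ℚ                               ∎)

rhsSeries-suc : ∀ s k n → rhsSeries (suc s) k (suc n) ≡ ℕ→ℚ (S (suc s) (suc n) k) * inv (+ (suc n !))
rhsSeries-suc s k n = begin
  ΣFPS k F (suc n) + 0ℚ
    ≡⟨ cong (λ x → ΣFPS k F (suc n) + x) (sym (ℚ.*-zeroˡ N)) ⟩
  ΣFPS k F (suc n) + 0ℚ * N
    ≡⟨ cong (λ x → ΣFPS k F (suc n) + x * N) (sym (ℚ.*-zeroʳ (inv (lagrangeDenom a k 0)))) ⟩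
  ΣFPS k F (suc n) + lagrangeTerm a k (suc n) 0 * N
    ≡⟨ ΣFPS-lagrange a k (suc n) ⟩
  dividedPower a k (suc n) * N
    ≡⟨ cong (_* N) (dividedPower-levelPowers s (suc n) k) ⟩
  ℕ→ℚ (S (suc s) (suc n) k) * N
    ∎
  where
  a = levelPowers (suc s)
  F = λ j → inv (lagrangeDenom a k j) ⊙ expS (a j)
  N = inv (+ (suc n !))

rhsSeries-zero : ∀ s k → rhsSeries (suc s) (suc k) 0 ≡ 0ℚ
rhsSeries-zero s k = begin
  ΣFPS (suc k) F 0 + ℤ→ℚ ε * inv (+ f)
    ≡⟨ cong (λ x → ΣFPS (suc k) F 0 + x) constant≡lagrangeTerm ⟩
  ΣFPS (suc k) F 0 + lagrangeTerm a (suc k) 0 0 * 1ℚ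
    ≡⟨ ΣFPS-lagrange a (suc k) 0 ⟩
  dividedPower a (suc k) 0 * 1ℚ
    ≡⟨ cong (_* 1ℚ) (dividedPower-zero (levelPowers-injective (suc s)) (suc k)) ⟩
  0ℚ
    ∎
  where
  a = levelPowers (suc s)
  F = λ j → inv (lagrangeDenom a (suc k) j) ⊙ expS (a j)
  ε = -[1+ 0 ] ℤ.^ suc k
  f = (suc k !) ℕ.^ suc s
  constant≡lagrangeTerm : ℤ→ℚ ε * inv (+ f) ≡ lagrangeTerm a (suc k) 0 0 * 1ℚ
  constant≡lagrangeTerm = begin
    ℤ→ℚ ε * inv (+ f)                 ≡⟨ cong (_* inv (+ f)) (sym (inv-sign (suc k))) ⟩
    inv ε * inv (+ f)                 ≡⟨ sym (inv-* ε (+ f)) ⟩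
    inv (ε ℤ.* + f)                   ≡⟨ cong inv (sym (lagrangeDenom-levelPowers-zero s (suc k))) ⟩
    inv (lagrangeDenom a (suc k) 0)   ≡⟨ sym (trans (ℚ.*-identityʳ _) (ℚ.*-identityʳ _)) ⟩
    lagrangeTerm a (suc k) 0 0 * 1ℚ   ∎

theorem2 : (s : ℕ) → 1 ≤ s → (k : ℕ) → 1 ≤ k →
    (n : ℕ) → lhsSeries s k n ≡ rhsSeries s k n
theorem2 (suc s) _ (suc k) _ zero    = sym (rhsSeries-zero s k)
theorem2 (suc s) _ k       _ (suc n) = trans (lhsSeries-coeff (suc s) k (suc n)) (sym (rhsSeries-suc s k n))
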